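{- Let $\pi$ be a permutation of $[n]$ and $\bm{y}$ an almost optimal displacement vector of $\pi$. Suppose that some cyclic ladder lottery in $\mathcal{L}^1(\pi,\bm{y})$ contains one or more tangled triples. Then every $L\in\mathcal{L}^1(\pi,\bm{y})$ with $\mathit{LT}(L)\ne\emptyset$ has a minimal left tangled triple.
   Context: Let $[n]=\{1,\dots,n\}$ and $\pi$ a permutation of $[n]$. A cyclic ladder lottery $L$ of $\pi$ consists of $n$ vertical lines $1,\dots,n$ and finitely many horizontal bars at distinct heights. Each bar connects lines $k,k+1$ ($1\le k\le n-1$) or lines $n,1$. Start with element $i$ on top of line $i$ and sweep downward; each bar swaps the elements on its two lines. At the bottom, line $j$ must carry $\pi_j$. Routes form $n$ $y$-monotone pseudolines on a cylinder whose intersections are the bars; lotteries are identified as pseudoline arrangements. $\mathcal{L}^1(\pi)$ consists of lotteries in which any two pseudolines cross at most once. $\mathit{DV}(L)=(x_1,\dots,x_n)$, where $x_i$ is the number of bars at which $i$ moves one line right (line $k\to k+1$ or $n\to1$) minus the number at which it moves left. $\bm{y}$ is almost optimal if $\bm{y}=\mathit{DV}(L)$ for some $L\in\mathcal{L}^1(\pi)$, and $\mathcal{L}^1(\pi,\bm{y})=\{L\in\mathcal{L}^1(\pi):\mathit{DV}(L)=\bm{y}\}$. A triple $\{i,j,k\}$ is tangled if its three pseudolines pairwise cross. Restricting to them, let $p$ be the intersection adjacent to two top endpoints, $q$ the one adjacent to one top and one bottom endpoint, and $r$ the one adjacent to two bottom endpoints. The triple is left tangled if $p,q,r$ appear counterclockwise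 on the boundary of the enclosed region, and right tangled if clockwise. It is minimal if the enclosed region contains no part of any other pseudoline. $\mathit{LT}(L)$ is the set of left tangled triples of $L$. -}

module Defs where

open import Data.Nat as ℕ using (ℕ; zero; suc)
open import Data.Nat.DivMod using (_mod_)
open import Data.Fin as Fin using (Fin; toℕ; _≟_)
open import Data.Fin.Permutation using (Permutation′; _⟨$⟩ʳ_)
open import Data.Integer as ℤ using (ℤ; +_)
open import Data.List using (List; []; _∷_; length; lookup)
open import Data.Product using (_×_; _,_; proj₁; proj₂; ∃-syntax)
open import Data.Sum using (_⊎_)
open import Relation.Binary.PropositionalEquality using (_≡_; _≢_)
open import Relation.Nullary using (¬_; yes; no)

-- Lines and elements are both indexed by Fin n (line k ↔ k+1 in the paper).
-- Cyclic successor of a line: k ↦ k+1 mod n (so line n-1 ↦ line 0, i.e. n ↦ 1).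
next : ∀ {n} → Fin n → Fin n
next {suc m} i = suc (toℕ i) mod suc m

-- A cyclic ladder lottery: the list of its bars from top to bottom
-- (distinct heights = list order). A bar k connects lines k and next k.
Lottery : ℕ → Set
Lottery n = List (Fin n)

-- A state assigns to each line the element currently on it.
State : ℕ → Set
State n = Fin n → Fin n

swapAt : ∀ {n} → Fin n → State n → State n
swapAt k σ j with j ≟ k
... | yes _ = σ (next k)
... | no _ with j ≟ next k
...   | yes _ = σ k
...   | no _  = σ j

final : ∀ {n} → State n → Lottery n → State n
final σ []       = σ
final σ (k ∷ ks) = final (swapAt k σ) ks

-- The crossings (bars) in top-to-bottom order, each recorded as
-- (element moving right, element moving left): at bar k the element on
-- line k moves to line next k (right), the one on line next k moves to k (left).
run : ∀ {n} → State n → Lottery n → List (Fin n × Fin n)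
run σ []       = []
run σ (k ∷ ks) = (σ k , σ (next k)) ∷ run (swapAt k σ) ks

idState : ∀ {n} → State n
idState j = j

crossings : ∀ {n} → Lottery n → List (Fin n × Fin n)
crossings L = run idState L

Time : ∀ {n} → Lottery n → Set
Time L = Fin (length (crossings L))

bar : ∀ {n} (L : Lottery n) → Time L → Fin n × Fin n
bar L t = lookup (crossings L) t

IsLotteryOf : ∀ {n} → Permutation′ n → Lottery n → Set
IsLotteryOf {n} π L = ∀ (j : Fin n) → final idState L j ≡ π ⟨$⟩ʳ j

dvList : ∀ {n} → List (Fin n × Fin n) → Fin n → ℤ
dvList []             i = + 0
dvList ((r , l) ∷ cs) i with r ≟ i | l ≟ i
... | yes _ | yes _ = dvList cs i
... | yes _ | no _  = (+ 1) ℤ.+ dvList cs i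
... | no _  | yes _ = ℤ.- (+ 1) ℤ.+ dvList cs i
... | no _  | no _  = dvList cs i

DV : ∀ {n} → Lottery n → Fin n → ℤ
DV L = dvList (crossings L)

isPair : ∀ {n} → Fin n → Fin n → Fin n × Fin n → Set
isPair i j c = (proj₁ c ≡ i × proj₂ c ≡ j) ⊎ (proj₁ c ≡ j × proj₂ c ≡ i)

involves : ∀ {n} → Fin n → Fin n × Fin n → Set
involves x c = proj₁ c ≡ x ⊎ proj₂ c ≡ x

CrossAt : ∀ {n} (L : Lottery n) → Time L → Fin n → Fin n → Set
CrossAt L t i j = isPair i j (bar L t)

AtMostOnce : ∀ {n} → Lottery n → Set
AtMostOnce {n} L = ∀ (i j : Fin n) → i ≢ j → ∀ (t t′ : Time L) →
  CrossAt L t i j → CrossAt L t′ i j → t ≡ t′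

InL1 : ∀ {n} → Permutation′ n → Lottery n → Set
InL1 π L = IsLotteryOf π L × AtMostOnce L

InL1y : ∀ {n} → Permutation′ n → (Fin n → ℤ) → Lottery n → Set
InL1y π y L = InL1 π L × (∀ i → DV L i ≡ y i)

AlmostOptimal : ∀ {n} → Permutation′ n → (Fin n → ℤ) → Set
AlmostOptimal {n} π y = ∃[ L ] InL1y {n} π y L

Distinct3 : ∀ {n} → Fin n → Fin n → Fin n → Set
Distinct3 a b c = a ≢ b × b ≢ c × a ≢ c

Tangled : ∀ {n} → Lottery n → Fin n → Fin n → Fin n → Set
Tangled L a b c = Distinct3 a b c ×
  (∃[ t₁ ] CrossAt L t₁ a b) × (∃[ t₂ ] CrossAt L t₂ b c) × (∃[ t₃ ] CrossAt L t₃ a c)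

HasTangled : ∀ {n} → Lottery n → Set
HasTangled L = ∃[ a ] ∃[ b ] ∃[ c ] Tangled L a b c

-- Left tangled configuration of the triple {u,v,w}, with p, q, r the first,
-- second and third crossing among the three (times tp < tq < tr):
-- at p, u moves right and v moves left, so just below p the enclosed region
-- has v on its left and u on its right; q lies on the left boundary (v meets w),
-- i.e. p, q, r are met counterclockwise; r is the crossing of u and w.
LeftTangledAt : ∀ {n} (L : Lottery n) → Fin n → Fin n → Fin n →
  Time L → Time L → Time L → Set
LeftTangledAt L u v w tp tq tr =
  Distinct3 u v w × tp Fin.< tq × tq Fin.< tr ×
  bar L tp ≡ (u , v) × CrossAt L tq v w × CrossAt L tr u w

HasLeftTangled : ∀ {n} → Lottery n → Set
HasLeftTangled L = ∃[ u ] ∃[ v ] ∃[ w ] ∃[ tp ] ∃[ tq ] ∃[ tr ]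
  LeftTangledAt L u v w tp tq tr

FreeSegment : ∀ {n} (L : Lottery n) → Fin n → Time L → Time L → Set
FreeSegment L x s s′ = ∀ (t : Time L) → s Fin.< t → t Fin.< s′ → ¬ involves x (bar L t)

-- Minimality: the region bounded by the segments v:[p,q], w:[q,r], u:[p,r]
-- contains no part of another pseudoline, i.e. no other pseudoline crosses
-- any of the three boundary segments.
Minimal : ∀ {n} (L : Lottery n) → Fin n → Fin n → Fin n →
  Time L → Time L → Time L → Set
Minimal L u v w tp tq tr =
  FreeSegment L v tp tq × FreeSegment L w tq tr × FreeSegment L u tp tr

HasMinimalLeftTangled : ∀ {n} → Lottery n → Set
HasMinimalLeftTangled L = ∃[ u ] ∃[ v ] ∃[ w ] ∃[ tp ] ∃[ tq ] ∃[ tr ]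
  (LeftTangledAt L u v w tp tq tr × Minimal L u v w tp tq tr)

-- Descent on the span r − p of a left tangled triple, where p < q < r are the times of its three
-- crossings. The cyclic order of the lines carrying three pseudolines can change only at a bar joining
-- two of them; this fixes the orientation of the bars at q and r, and when a further pseudoline x meets
-- a side of the triangle, the cyclic order of x and the two pseudolines of an adjacent side must flip
-- before that side ends. The bar responsible for the flip completes a left tangled triple containing x
-- whose crossings lie in a strictly shorter time window. A triple none of whose sides is met is minimal.
module Submission where

open import Defs
open import Data.Nat using (ℕ)
open import Data.Fin using (Fin)
open import Data.Fin.Permutation using (Permutation′)
open import Data.Integer using (ℤ)
open import Data.Product using (_×_; ∃-syntax)

open import Data.Empty using (⊥; ⊥-elim)
open import Data.Fin as Fin using (toℕ; fromℕ<; _≟_)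
open import Data.Fin.Permutation.Components using (transpose; transpose-inverse)
open import Data.Fin.Properties using (toℕ-fromℕ<; toℕ-injective; toℕ<n)
open import Data.List using ([]; _∷_; length; lookup; take)
open import Data.Nat using (zero; suc; _<_; _≤_; _∸_; _<?_; _%_)
open import Data.Nat.DivMod using (m<n⇒m%n≡m; n%n≡0)
open import Data.Nat.Induction using (<-wellFounded)
open import Data.Nat.Properties hiding (_≟_)
open import Data.Product using (Σ-syntax; _,_; proj₁; proj₂)
open import Data.Sum using (_⊎_; inj₁; inj₂)
open import Function using (_∘_)
open import Induction.WellFounded using (Acc; acc)
open import Relation.Binary.Definitions using (tri<; tri≈; tri>)
open import Relation.Binary.PropositionalEquality
open import Relation.Nullary using (¬_; Dec; yes; no)
open import Relation.Nullary.Decidable using (_×-dec_; _⊎-dec_)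
open import Relation.Unary using (Decidable)

Cyclic : ℕ → ℕ → ℕ → Set
Cyclic i j l = (i < j × j < l) ⊎ (j < l × l < i) ⊎ (l < i × i < j)

cyclic-rotate : ∀ {i j l} → Cyclic i j l → Cyclic j l i
cyclic-rotate (inj₁ h)        = inj₂ (inj₂ h)
cyclic-rotate (inj₂ (inj₁ h)) = inj₁ h
cyclic-rotate (inj₂ (inj₂ h)) = inj₂ (inj₁ h)

cyclic-asym : ∀ {i j l} → Cyclic i j l → ¬ Cyclic i l j
cyclic-asym (inj₁ (_ , j<l))        (inj₁ (_ , l<j))        = <-asym j<l l<j
cyclic-asym (inj₁ (_ , j<l))        (inj₂ (inj₁ (l<j , _))) = <-asym j<l l<j
cyclic-asym (inj₁ (i<j , _))        (inj₂ (inj₂ (j<i , _))) = <-asym i<j j<i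
cyclic-asym (inj₂ (inj₁ (_ , l<i))) (inj₁ (i<l , _))        = <-asym i<l l<i
cyclic-asym (inj₂ (inj₁ (j<l , _))) (inj₂ (inj₁ (l<j , _))) = <-asym j<l l<j
cyclic-asym (inj₂ (inj₁ (_ , l<i))) (inj₂ (inj₂ (_ , i<l))) = <-asym i<l l<i
cyclic-asym (inj₂ (inj₂ (l<i , _))) (inj₁ (i<l , _))        = <-asym i<l l<i
cyclic-asym (inj₂ (inj₂ (_ , i<j))) (inj₂ (inj₁ (_ , j<i))) = <-asym i<j j<i
cyclic-asym (inj₂ (inj₂ (_ , i<j))) (inj₂ (inj₂ (j<i , _))) = <-asym i<j j<i

cyclic-trans : ∀ {a b c d} → Cyclic a b c → Cyclic a c d → Cyclic a b d
cyclic-trans (inj₁ (a<b , b<c))        (inj₁ (_ , c<d))          = inj₁ (a<b , <-trans b<c c<d)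
cyclic-trans (inj₁ (a<b , b<c))        (inj₂ (inj₁ (c<d , d<a))) =
  ⊥-elim (<-asym d<a (<-trans a<b (<-trans b<c c<d)))
cyclic-trans (inj₁ (a<b , _))          (inj₂ (inj₂ (d<a , _)))   = inj₂ (inj₂ (d<a , a<b))
cyclic-trans (inj₂ (inj₁ (_ , c<a)))   (inj₁ (a<c , _))          = ⊥-elim (<-asym a<c c<a)
cyclic-trans (inj₂ (inj₁ (b<c , _)))   (inj₂ (inj₁ (c<d , d<a))) = inj₂ (inj₁ (<-trans b<c c<d , d<a))
cyclic-trans (inj₂ (inj₁ (_ , c<a)))   (inj₂ (inj₂ (_ , a<c)))   = ⊥-elim (<-asym a<c c<a)
cyclic-trans (inj₂ (inj₂ (c<a , _)))   (inj₁ (a<c , _))          = ⊥-elim (<-asym a<c c<a)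
cyclic-trans (inj₂ (inj₂ (_ , a<b)))   (inj₂ (inj₁ (_ , d<a)))   = inj₂ (inj₂ (d<a , a<b))
cyclic-trans (inj₂ (inj₂ (c<a , _)))   (inj₂ (inj₂ (_ , a<c)))   = ⊥-elim (<-asym a<c c<a)

IsCyclicSucc : ℕ → ℕ → ℕ → Set
IsCyclicSucc N k k′ = (k′ ≡ suc k × suc k < N) ⊎ (k′ ≡ 0 × suc k ≡ N)

cyclic-succ : ∀ {N k k′ l} → IsCyclicSucc N k k′ → l < N → l ≢ k → l ≢ k′ → Cyclic k k′ l
cyclic-succ {k = k} {l = l} (inj₁ (refl , _)) _ l≢k l≢k′ with <-cmp l k
... | tri< l<k _ _ = inj₂ (inj₂ (l<k , n<1+n k))
... | tri≈ _ l≡k _ = ⊥-elim (l≢k l≡k)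
... | tri> _ _ k<l = inj₁ (n<1+n k , ≤∧≢⇒< k<l (≢-sym l≢k′))
cyclic-succ (inj₂ (refl , refl)) l<N l≢k l≢0 =
  inj₂ (inj₁ (n≢0⇒n>0 l≢0 , ≤∧≢⇒< (≤-pred l<N) l≢k))

cyclic-shift : ∀ {N k k′ j l} → IsCyclicSucc N k k′ → j < N → j ≢ k → j ≢ k′ →
  Cyclic k j l → Cyclic k′ j l
cyclic-shift {k = k} (inj₁ (refl , _)) _ _ j≢k′ (inj₁ (k<j , j<l)) =
  inj₁ (≤∧≢⇒< k<j (≢-sym j≢k′) , j<l)
cyclic-shift {k = k} (inj₁ (refl , _)) _ _ _ (inj₂ (inj₁ (j<l , l<k))) =
  inj₂ (inj₁ (j<l , <-trans l<k (n<1+n k)))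
cyclic-shift {k = k} (inj₁ (refl , _)) _ _ j≢k′ (inj₂ (inj₂ (l<k , k<j))) =
  inj₂ (inj₂ (<-trans l<k (n<1+n k) , ≤∧≢⇒< k<j (≢-sym j≢k′)))
cyclic-shift (inj₂ (refl , refl)) j<N j≢k _ (inj₁ (k<j , _)) =
  ⊥-elim (<-asym k<j (≤∧≢⇒< (≤-pred j<N) j≢k))
cyclic-shift (inj₂ (refl , refl)) _ _ j≢0 (inj₂ (inj₁ (j<l , _))) =
  inj₁ (n≢0⇒n>0 j≢0 , j<l)
cyclic-shift (inj₂ (refl , refl)) j<N j≢k _ (inj₂ (inj₂ (_ , k<j))) =
  ⊥-elim (<-asym k<j (≤∧≢⇒< (≤-pred j<N) j≢k))

cyclic-unshift : ∀ {N k k′ j l} → IsCyclicSucc N k k′ → l < N → l ≢ k →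
  Cyclic k′ j l → Cyclic k j l
cyclic-unshift {k = k} (inj₁ (refl , _)) _ _ (inj₁ (k′<j , j<l)) =
  inj₁ (<-trans (n<1+n k) k′<j , j<l)
cyclic-unshift (inj₁ (refl , _)) _ l≢k (inj₂ (inj₁ (j<l , l<k′))) =
  inj₂ (inj₁ (j<l , ≤∧≢⇒< (≤-pred l<k′) l≢k))
cyclic-unshift {k = k} (inj₁ (refl , _)) _ l≢k (inj₂ (inj₂ (l<k′ , k′<j))) =
  inj₂ (inj₂ (≤∧≢⇒< (≤-pred l<k′) l≢k , <-trans (n<1+n k) k′<j))
cyclic-unshift (inj₂ (refl , refl)) l<N l≢k (inj₁ (_ , j<l)) =
  inj₂ (inj₁ (j<l , ≤∧≢⇒< (≤-pred l<N) l≢k))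
cyclic-unshift (inj₂ (refl , refl)) _ _ (inj₂ (inj₁ (_ , ())))
cyclic-unshift (inj₂ (refl , refl)) _ _ (inj₂ (inj₂ (() , _)))

next-isCyclicSucc : ∀ {n} (k : Fin n) → IsCyclicSucc n (toℕ k) (toℕ (next k))
next-isCyclicSucc {suc m} k with m≤n⇒m<n∨m≡n (toℕ<n k)
... | inj₁ 1+k<n = inj₁ (trans (toℕ-fromℕ< _) (m<n⇒m%n≡m 1+k<n) , 1+k<n)
... | inj₂ 1+k≡n =
  inj₂ (trans (toℕ-fromℕ< _) (trans (cong (_% suc m) 1+k≡n) (n%n≡0 (suc m))) , 1+k≡n)

next≢ : ∀ {n} {u v : Fin n} → u ≢ v → (k : Fin n) → next k ≢ k
next≢ {n} {u} {v} u≢v k next≡k with next-isCyclicSucc k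
... | inj₁ (next≡1+k , _) = 1+n≢n (trans (sym next≡1+k) (cong toℕ next≡k))
... | inj₂ (next≡0 , 1+k≡n) = u≢v (toℕ-injective (trans (toℕ≡0 u) (sym (toℕ≡0 v))))
  where
  n≡1 : n ≡ 1
  n≡1 = trans (sym 1+k≡n) (cong suc (trans (cong toℕ (sym next≡k)) next≡0))
  toℕ≡0 : (x : Fin n) → toℕ x ≡ 0
  toℕ≡0 x = n<1⇒n≡0 (subst (toℕ x <_) n≡1 (toℕ<n x))

transpose-left : ∀ {n} (i j : Fin n) → transpose i j i ≡ j
transpose-left i j with i ≟ i
... | yes _   = refl
... | no i≢i = ⊥-elim (i≢i refl)

transpose-right : ∀ {n} (i j : Fin n) → transpose i j j ≡ i
transpose-right i j with j ≟ i
... | yes j≡i = j≡i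
... | no _ with j ≟ j
...   | yes _   = refl
...   | no j≢j = ⊥-elim (j≢j refl)

transpose-fixes : ∀ {n} {i j k : Fin n} → k ≢ i → k ≢ j → transpose i j k ≡ k
transpose-fixes {i = i} {j} {k} k≢i k≢j with k ≟ i
... | yes k≡i = ⊥-elim (k≢i k≡i)
... | no _ with k ≟ j
...   | yes k≡j = ⊥-elim (k≢j k≡j)
...   | no _    = refl

swapAt-transpose : ∀ {n} (k : Fin n) (σ : State n) j → swapAt k σ j ≡ σ (transpose k (next k) j)
swapAt-transpose k σ j with j ≟ k
... | yes _ = refl
... | no _ with j ≟ next k
...   | yes _ = refl
...   | no _  = refl

CyclicFin : ∀ {n} → Fin n → Fin n → Fin n → Set
CyclicFin i j l = Cyclic (toℕ i) (toℕ j) (toℕ l)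

OffBar : ∀ {n} → Fin n → Fin n → Set
OffBar k j = j ≢ k × j ≢ next k

cyclic-transpose : ∀ {n} {k i j l : Fin n} → OffBar k j → OffBar k l → CyclicFin i j l →
  CyclicFin (transpose (next k) k i) (transpose (next k) k j) (transpose (next k) k l)
cyclic-transpose {k = k} {i} {j} {l} (j≢k , j≢k′) (l≢k , l≢k′) h
  rewrite transpose-fixes j≢k′ j≢k | transpose-fixes l≢k′ l≢k = moved (i ≟ k) (i ≟ next k)
  where
  moved : Dec (i ≡ k) → Dec (i ≡ next k) → CyclicFin (transpose (next k) k i) j l
  moved (yes i≡k) _ rewrite cong (transpose (next k) k) i≡k | transpose-right (next k) k =
    cyclic-shift (next-isCyclicSucc k) (toℕ<n j) (j≢k ∘ toℕ-injective) (j≢k′ ∘ toℕ-injective)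
      (subst (λ x → CyclicFin x j l) i≡k h)
  moved (no _) (yes i≡k′) rewrite cong (transpose (next k) k) i≡k′ | transpose-left (next k) k =
    cyclic-unshift (next-isCyclicSucc k) (toℕ<n l) (l≢k ∘ toℕ-injective)
      (subst (λ x → CyclicFin x j l) i≡k′ h)
  moved (no i≢k) (no i≢k′) rewrite transpose-fixes i≢k′ i≢k = h

cyclic-next : ∀ {n} {k l : Fin n} → OffBar k l → CyclicFin k (next k) l
cyclic-next {k = k} (l≢k , l≢k′) =
  cyclic-succ (next-isCyclicSucc k) (toℕ<n _) (l≢k ∘ toℕ-injective) (l≢k′ ∘ toℕ-injective)

AreInverse : ∀ {n} → (Fin n → Fin n) → (Fin n → Fin n) → Set
AreInverse σ P = (∀ x → σ (P x) ≡ x) × (∀ j → P (σ j) ≡ j)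

-- A State maps lines to elements; lineOf tracks the inverse map, from elements to lines.
lineOf : ∀ {n} → (Fin n → Fin n) → Lottery n → Fin n → Fin n
lineOf P []       = P
lineOf P (k ∷ ks) = lineOf (transpose (next k) k ∘ P) ks

lineOf-inverse : ∀ {n} {σ P : Fin n → Fin n} (ks : Lottery n) →
  AreInverse σ P → AreInverse (final σ ks) (lineOf P ks)
lineOf-inverse []       inv             = inv
lineOf-inverse {σ = σ} {P} (k ∷ ks) (σ∘P≗id , P∘σ≗id) =
  lineOf-inverse ks (σ∘P′≗id , P′∘σ≗id)
  where
  σ∘P′≗id : ∀ x → swapAt k σ (transpose (next k) k (P x)) ≡ x
  σ∘P′≗id x = begin
    swapAt k σ (transpose (next k) k (P x))
      ≡⟨ swapAt-transpose k σ (transpose (next k) k (P x)) ⟩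
    σ (transpose k (next k) (transpose (next k) k (P x)))
      ≡⟨ cong σ (transpose-inverse k (next k)) ⟩
    σ (P x)
      ≡⟨ σ∘P≗id x ⟩
    x ∎
    where open ≡-Reasoning
  P′∘σ≗id : ∀ j → transpose (next k) k (P (swapAt k σ j)) ≡ j
  P′∘σ≗id j = begin
    transpose (next k) k (P (swapAt k σ j))
      ≡⟨ cong (transpose (next k) k ∘ P) (swapAt-transpose k σ j) ⟩
    transpose (next k) k (P (σ (transpose k (next k) j)))
      ≡⟨ cong (transpose (next k) k) (P∘σ≗id _) ⟩
    transpose (next k) k (transpose k (next k) j)
      ≡⟨ transpose-inverse (next k) k ⟩
    j ∎
    where open ≡-Reasoning

run-lookup : ∀ {n} (L : Lottery n) (σ : State n) (P : Fin n → Fin n) (i : Fin (length (run σ L))) →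
  ∃[ k ] (lookup (run σ L) i ≡ (final σ (take (toℕ i) L) k , final σ (take (toℕ i) L) (next k))
          × lineOf P (take (suc (toℕ i)) L) ≗ transpose (next k) k ∘ lineOf P (take (toℕ i) L))
run-lookup (k ∷ L) σ P Fin.zero    = k , refl , λ _ → refl
run-lookup (k ∷ L) σ P (Fin.suc i) = run-lookup L (swapAt k σ) (transpose (next k) k ∘ P) i

CrossesTwoOf : ∀ {n} → Fin n → Fin n → Fin n → Fin n × Fin n → Set
CrossesTwoOf a b c cr = isPair a b cr ⊎ isPair b c cr ⊎ isPair a c cr

module _ {n : ℕ} where

  isPair? : (i j : Fin n) → Decidable (isPair i j)
  isPair? i j (x , y) = ((x ≟ i) ×-dec (y ≟ j)) ⊎-dec ((x ≟ j) ×-dec (y ≟ i))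

  involves? : (x : Fin n) → Decidable (involves x)
  involves? x (r , l) = (r ≟ x) ⊎-dec (l ≟ x)

  crossesTwoOf? : (a b c : Fin n) → Decidable (CrossesTwoOf a b c)
  crossesTwoOf? a b c cr = isPair? a b cr ⊎-dec isPair? b c cr ⊎-dec isPair? a c cr

  isPair-sym : ∀ {i j : Fin n} {cr} → isPair i j cr → isPair j i cr
  isPair-sym (inj₁ h) = inj₂ h
  isPair-sym (inj₂ h) = inj₁ h

  ≡⇒isPair : ∀ {i j : Fin n} {cr} → cr ≡ (i , j) → isPair i j cr
  ≡⇒isPair refl = inj₁ (refl , refl)

  isPair⇒≡ : ∀ {i j : Fin n} {cr} → isPair i j cr → cr ≡ (i , j) ⊎ cr ≡ (j , i)
  isPair⇒≡ (inj₁ (refl , refl)) = inj₁ refl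
  isPair⇒≡ (inj₂ (refl , refl)) = inj₂ refl

  isPair⇒involves : ∀ {i j : Fin n} {cr} → isPair i j cr → involves i cr
  isPair⇒involves (inj₁ (eq , _)) = inj₁ eq
  isPair⇒involves (inj₂ (_ , eq)) = inj₂ eq

  involves⇒isPair : ∀ {i j : Fin n} {cr} → involves i cr → involves j cr → i ≢ j → isPair i j cr
  involves⇒isPair (inj₁ refl) (inj₁ refl) i≢j = ⊥-elim (i≢j refl)
  involves⇒isPair (inj₁ refl) (inj₂ refl) _   = inj₁ (refl , refl)
  involves⇒isPair (inj₂ refl) (inj₁ refl) _   = inj₂ (refl , refl)
  involves⇒isPair (inj₂ refl) (inj₂ refl) i≢j = ⊥-elim (i≢j refl)

  involves⇒≡ : ∀ {x : Fin n} {cr} → involves x cr → cr ≡ (x , proj₂ cr) ⊎ cr ≡ (proj₁ cr , x)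
  involves⇒≡ (inj₁ refl) = inj₁ refl
  involves⇒≡ (inj₂ refl) = inj₂ refl

  ¬involves : ∀ {a b c : Fin n} {cr} → cr ≡ (a , b) → c ≢ a → c ≢ b → ¬ involves c cr
  ¬involves refl c≢a _ (inj₁ refl) = c≢a refl
  ¬involves refl _ c≢b (inj₂ refl) = c≢b refl

module Lines {n} (L : Lottery n) where

  stateAt : ℕ → State n
  stateAt t = final idState (take t L)

  lineAt : ℕ → Fin n → Fin n
  lineAt t = lineOf (λ x → x) (take t L)

  lineAt-inverse : ∀ t → AreInverse (stateAt t) (lineAt t)
  lineAt-inverse t = lineOf-inverse (take t L) ((λ _ → refl) , (λ _ → refl))

  CyclicAt : ℕ → Fin n → Fin n → Fin n → Set
  CyclicAt t a b c = CyclicFin (lineAt t a) (lineAt t b) (lineAt t c)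

  module Step (T : Time L) where

    t : ℕ
    t = toℕ T

    k : Fin n
    k = proj₁ (run-lookup L idState (λ x → x) T)

    bar≡ : bar L T ≡ (stateAt t k , stateAt t (next k))
    bar≡ = proj₁ (proj₂ (run-lookup L idState (λ x → x) T))

    lineAt-suc : lineAt (suc t) ≗ transpose (next k) k ∘ lineAt t
    lineAt-suc = proj₂ (proj₂ (run-lookup L idState (λ x → x) T))

    line-of-right : ∀ {a b} → bar L T ≡ (a , b) → lineAt t a ≡ k
    line-of-right eq =
      trans (cong (lineAt t ∘ proj₁) (trans (sym eq) bar≡)) (proj₂ (lineAt-inverse t) k)

    line-of-left : ∀ {a b} → bar L T ≡ (a , b) → lineAt t b ≡ next k
    line-of-left eq =
      trans (cong (lineAt t ∘ proj₂) (trans (sym eq) bar≡)) (proj₂ (lineAt-inverse t) (next k))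

    off-bar : ∀ {x} → ¬ involves x (bar L T) → OffBar k (lineAt t x)
    off-bar {x} ¬inv = (λ on-k → ¬inv (inj₁ (carries (cong proj₁ bar≡) on-k)))
                     , (λ on-k′ → ¬inv (inj₂ (carries (cong proj₂ bar≡) on-k′)))
      where
      carries : ∀ {y j} → y ≡ stateAt t j → lineAt t x ≡ j → y ≡ x
      carries y≡ refl = trans y≡ (proj₁ (lineAt-inverse t) x)

    cyclicAt-suc : ∀ {a b c} →
      CyclicFin (transpose (next k) k (lineAt t a)) (transpose (next k) k (lineAt t b))
                (transpose (next k) k (lineAt t c)) →
      CyclicFin (lineAt (suc t) a) (lineAt (suc t) b) (lineAt (suc t) c)
    cyclicAt-suc {a} {b} {c} h rewrite lineAt-suc a | lineAt-suc b | lineAt-suc c = h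

    cyclicAt-step : ∀ {a b c} → a ≢ b → b ≢ c → a ≢ c → ¬ CrossesTwoOf a b c (bar L T) →
      CyclicAt t a b c → CyclicAt (suc t) a b c
    cyclicAt-step {a} {b} {c} a≢b b≢c a≢c ¬two h
      with involves? a (bar L T) | involves? b (bar L T) | involves? c (bar L T)
    ... | yes ia | yes ib | _      = ⊥-elim (¬two (inj₁ (involves⇒isPair ia ib a≢b)))
    ... | _      | yes ib | yes ic = ⊥-elim (¬two (inj₂ (inj₁ (involves⇒isPair ib ic b≢c))))
    ... | yes ia | _      | yes ic = ⊥-elim (¬two (inj₂ (inj₂ (involves⇒isPair ia ic a≢c))))
    ... | _      | no ¬ib | no ¬ic = cyclicAt-suc (cyclic-transpose (off-bar ¬ib) (off-bar ¬ic) h)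
    ... | no ¬ia | yes _  | no ¬ic =
      cyclic-rotate (cyclic-rotate
        (cyclicAt-suc (cyclic-transpose (off-bar ¬ic) (off-bar ¬ia) (cyclic-rotate h))))
    ... | no ¬ia | no ¬ib | yes _  =
      cyclic-rotate
        (cyclicAt-suc (cyclic-transpose (off-bar ¬ia) (off-bar ¬ib) (cyclic-rotate (cyclic-rotate h))))

    cyclicAt-before : ∀ {a b c} → bar L T ≡ (a , b) → c ≢ a → c ≢ b → CyclicAt t a b c
    cyclicAt-before eq c≢a c≢b rewrite line-of-right eq | line-of-left eq =
      cyclic-next (off-bar (¬involves eq c≢a c≢b))

    cyclicAt-after : ∀ {a b c} → bar L T ≡ (a , b) → c ≢ a → c ≢ b → CyclicAt (suc t) b a c
    cyclicAt-after {a} {b} {c} eq c≢a c≢b = cyclicAt-suc moved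
      where
      off : OffBar k (lineAt t c)
      off = off-bar (¬involves eq c≢a c≢b)
      moved : CyclicFin (transpose (next k) k (lineAt t b)) (transpose (next k) k (lineAt t a))
                        (transpose (next k) k (lineAt t c))
      moved rewrite line-of-right eq | line-of-left eq | transpose-left (next k) k
                  | transpose-right (next k) k | transpose-fixes (proj₂ off) (proj₁ off) = cyclic-next off

    bar-distinct : ((j : Fin n) → next j ≢ j) → ∀ {a b} → bar L T ≡ (a , b) → a ≢ b
    bar-distinct next≢id eq refl = next≢id k (trans (sym (line-of-left eq)) (line-of-right eq))

module _ {m : ℕ} where

  NoneBetween : (Fin m → Set) → ℕ → ℕ → Set
  NoneBetween P lo hi = ∀ T → lo < toℕ T → toℕ T < hi → ¬ P T

  noneBetween-suc : ∀ {P : Fin m → Set} {lo h} (h<m : h < m) → ¬ P (fromℕ< h<m) →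
    NoneBetween P lo h → NoneBetween P lo (suc h)
  noneBetween-suc {P} h<m ¬p none T lo<T T<1+h with m≤n⇒m<n∨m≡n (≤-pred T<1+h)
  ... | inj₁ T<h = none T lo<T T<h
  ... | inj₂ T≡h = subst (¬_ ∘ P) (toℕ-injective (trans (toℕ-fromℕ< h<m) (sym T≡h))) ¬p

  last-in-interval : (P : Fin m → Set) → Decidable P → ∀ lo hi → hi ≤ m →
    NoneBetween P lo hi ⊎ ∃[ T ] (lo < toℕ T × toℕ T < hi × P T × NoneBetween P (toℕ T) hi)
  last-in-interval P P? lo zero    _    = inj₁ (λ _ _ ())
  last-in-interval P P? lo (suc h) h<m with lo <? h
  ... | no lo≮h = inj₁ (λ T lo<T T<1+h _ → lo≮h (<-≤-trans lo<T (≤-pred T<1+h)))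
  ... | yes lo<h with P? (fromℕ< h<m) | last-in-interval P P? lo h (<⇒≤ h<m)
  ...   | yes p  | _ =
    inj₂ (fromℕ< h<m , subst (lo <_) (sym h≡) lo<h , subst (_< suc h) (sym h≡) ≤-refl , p ,
          λ T h<T T<1+h _ → <⇒≱ (subst (_< toℕ T) h≡ h<T) (≤-pred T<1+h))
    where h≡ = toℕ-fromℕ< h<m
  ...   | no ¬p | inj₁ none = inj₁ (noneBetween-suc h<m ¬p none)
  ...   | no ¬p | inj₂ (T , lo<T , T<h , p , none) =
    inj₂ (T , lo<T , m<n⇒m<1+n T<h , p , noneBetween-suc h<m ¬p none)

  propagate : (Q : ℕ → Set) (Bad : Fin m → Set) →
    (∀ T → ¬ Bad T → Q (toℕ T) → Q (suc (toℕ T))) →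
    ∀ {lo hi} → lo < hi → hi ≤ m → NoneBetween Bad lo hi → Q (suc lo) → Q hi
  propagate Q Bad step {lo} {suc h} lo<1+h h<m none q with m≤n⇒m<n∨m≡n (≤-pred lo<1+h)
  ... | inj₂ refl = q
  ... | inj₁ lo<h = subst (Q ∘ suc) h≡ (step S (none S lo<S S<1+h) (subst Q (sym h≡) q-at-h))
    where
    S = fromℕ< h<m
    h≡ = toℕ-fromℕ< h<m
    lo<S = subst (lo <_) (sym h≡) lo<h
    S<1+h = subst (_< suc h) (sym h≡) ≤-refl
    q-at-h : Q h
    q-at-h = propagate Q Bad step lo<h (<⇒≤ h<m) (λ T lo<T T<h → none T lo<T (m<n⇒m<1+n T<h)) q

  change-witness : (Q : ℕ → Set) (Bad : Fin m → Set) → Decidable Bad →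
    (∀ T → ¬ Bad T → Q (toℕ T) → Q (suc (toℕ T))) →
    ∀ {lo hi} → lo < hi → hi ≤ m → Q (suc lo) → ¬ Q hi →
    ∃[ T ] (lo < toℕ T × toℕ T < hi × Bad T)
  change-witness Q Bad Bad? step {lo} {hi} lo<hi hi≤m q ¬q with last-in-interval Bad Bad? lo hi hi≤m
  ... | inj₁ none                      = ⊥-elim (¬q (propagate Q Bad step lo<hi hi≤m none q))
  ... | inj₂ (T , lo<T , T<hi , b , _) = T , lo<T , T<hi , b

∸-shrinks : ∀ {p r p′ r′} → p ≤ p′ → r′ ≤ r → p′ ≤ r′ → p < p′ ⊎ r′ < r → r′ ∸ p′ < r ∸ p
∸-shrinks {p′ = p′} _ r′≤r p′≤r′ (inj₁ p<p′) =
  ≤-<-trans (∸-monoˡ-≤ p′ r′≤r) (∸-monoʳ-< p<p′ (≤-trans p′≤r′ r′≤r))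
∸-shrinks {r′ = r′} p≤p′ _ p′≤r′ (inj₂ r′<r) =
  ≤-<-trans (∸-monoʳ-≤ r′ p≤p′) (∸-monoˡ-< r′<r (≤-trans p≤p′ p′≤r′))

module Descent {n} (L : Lottery n) (next≢id : (j : Fin n) → next j ≢ j) (once : AtMostOnce L) where

  open Lines L

  toℕ≤length : (T : Time L) → toℕ T ≤ length (crossings L)
  toℕ≤length T = <⇒≤ (toℕ<n T)

  ¬cross-after : ∀ {i j T₀ T} → i ≢ j → CrossAt L T₀ i j → CrossAt L T i j → ¬ toℕ T₀ < toℕ T
  ¬cross-after i≢j c₀ c = <-irrefl (cong toℕ (once _ _ i≢j _ _ c₀ c))

  ¬cross-before : ∀ {i j T₀ T} → i ≢ j → CrossAt L T₀ i j → CrossAt L T i j → ¬ toℕ T < toℕ T₀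
  ¬cross-before i≢j c₀ c = <-irrefl (cong toℕ (once _ _ i≢j _ _ c c₀))

  partner≢ : ∀ {i j x T₀ T} → i ≢ j → CrossAt L T₀ i j → CrossAt L T i x →
    toℕ T ≢ toℕ T₀ → x ≢ j
  partner≢ i≢j c₀ c T≢T₀ refl = T≢T₀ (cong toℕ (once _ _ i≢j _ _ c c₀))

  cyclicAt-keep : ∀ {a b c lo hi} → a ≢ b → b ≢ c → a ≢ c →
    lo < hi → hi ≤ length (crossings L) →
    NoneBetween (CrossesTwoOf a b c ∘ bar L) lo hi → CyclicAt (suc lo) a b c → CyclicAt hi a b c
  cyclicAt-keep {a} {b} {c} a≢b b≢c a≢c =
    propagate (λ t → CyclicAt t a b c) _ (λ T → Step.cyclicAt-step T a≢b b≢c a≢c)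

  cyclicAt-change : ∀ {a b c lo hi} → a ≢ b → b ≢ c → a ≢ c →
    lo < hi → hi ≤ length (crossings L) →
    CyclicAt (suc lo) a b c → ¬ CyclicAt hi a b c →
    ∃[ T ] (lo < toℕ T × toℕ T < hi × CrossesTwoOf a b c (bar L T))
  cyclicAt-change {a} {b} {c} a≢b b≢c a≢c =
    change-witness (λ t → CyclicAt t a b c) _ (crossesTwoOf? a b c ∘ bar L)
      (λ T → Step.cyclicAt-step T a≢b b≢c a≢c)

  span : HasLeftTangled L → ℕ
  span (_ , _ , _ , tp , _ , tr , _) = toℕ tr ∸ toℕ tp

  module Triangle {u v w : Fin n} {tp tq tr : Time L}
    (u≢v : u ≢ v) (v≢w : v ≢ w) (u≢w : u ≢ w) (p<q : tp Fin.< tq) (q<r : tq Fin.< tr)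
    (bar-p : bar L tp ≡ (u , v)) (cross-q : CrossAt L tq v w) (cross-r : CrossAt L tr u w) where

    p q r : ℕ
    p = toℕ tp
    q = toℕ tq
    r = toℕ tr

    Narrower : Set
    Narrower = Σ[ t ∈ HasLeftTangled L ] span t < r ∸ p

    narrower : ∀ {u′ v′ w′ tp′ tq′ tr′} → LeftTangledAt L u′ v′ w′ tp′ tq′ tr′ →
      p ≤ toℕ tp′ → toℕ tr′ ≤ r → p < toℕ tp′ ⊎ toℕ tr′ < r → Narrower
    narrower lt@(_ , p′<q′ , q′<r′ , _) p≤p′ r′≤r shrinks =
      (_ , _ , _ , _ , _ , _ , lt) , ∸-shrinks p≤p′ r′≤r (<⇒≤ (<-trans p′<q′ q′<r′)) shrinks

    vuw-at-q : CyclicAt q v u w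
    vuw-at-q = cyclicAt-keep (≢-sym u≢v) u≢w v≢w p<q (toℕ≤length tq) no-crossing
                 (Step.cyclicAt-after tp bar-p (≢-sym u≢w) (≢-sym v≢w))
      where
      no-crossing : NoneBetween (CrossesTwoOf v u w ∘ bar L) p q
      no-crossing T p<T _   (inj₁ vu)        = ¬cross-after u≢v (≡⇒isPair bar-p) (isPair-sym vu) p<T
      no-crossing T _   T<q (inj₂ (inj₁ uw)) = ¬cross-before u≢w cross-r uw (<-trans T<q q<r)
      no-crossing T _   T<q (inj₂ (inj₂ vw)) = ¬cross-before v≢w cross-q vw T<q

    bar-q : bar L tq ≡ (w , v)
    bar-q with isPair⇒≡ cross-q
    ... | inj₁ vw = ⊥-elim (cyclic-asym vuw-at-q (Step.cyclicAt-before tq vw u≢v u≢w))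
    ... | inj₂ wv = wv

    vwu-at : ∀ {t} → q < t → t ≤ r → CyclicAt t v w u
    vwu-at {t} q<t t≤r =
      cyclicAt-keep v≢w (≢-sym u≢w) (≢-sym u≢v) q<t (≤-trans t≤r (toℕ≤length tr)) no-crossing
        (Step.cyclicAt-after tq bar-q u≢w u≢v)
      where
      no-crossing : NoneBetween (CrossesTwoOf v w u ∘ bar L) q t
      no-crossing T q<T _   (inj₁ vw)        = ¬cross-after v≢w cross-q vw q<T
      no-crossing T _   T<t (inj₂ (inj₁ wu)) =
        ¬cross-before u≢w cross-r (isPair-sym wu) (<-≤-trans T<t t≤r)
      no-crossing T q<T _   (inj₂ (inj₂ vu)) =
        ¬cross-after u≢v (≡⇒isPair bar-p) (isPair-sym vu) (<-trans p<q q<T)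

    bar-r : bar L tr ≡ (w , u)
    bar-r with isPair⇒≡ cross-r
    ... | inj₁ uw = ⊥-elim (cyclic-asym (cyclic-rotate (cyclic-rotate (vwu-at q<r ≤-refl)))
                                        (Step.cyclicAt-before tr uw (≢-sym u≢v) v≢w))
    ... | inj₂ wu = wu

    v-moves-right : ∀ {a x} → bar L a ≡ (v , x) → p < toℕ a → toℕ a < q →
      NoneBetween (involves v ∘ bar L) (toℕ a) q → Narrower
    v-moves-right {a} {x} bar-a p<a a<q v-free =
      from-crossing (cyclicAt-change v≢w (≢-sym x≢w) v≢x a<q (toℕ≤length tq) vwx-after-a ¬vwx-at-q)
      where
      v≢x : v ≢ x
      v≢x = Step.bar-distinct a next≢id bar-a
      x≢w : x ≢ w
      x≢w = partner≢ v≢w cross-q (≡⇒isPair bar-a) (<⇒≢ a<q)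
      vwx-after-a : CyclicAt (suc (toℕ a)) v w x
      vwx-after-a = cyclic-rotate (Step.cyclicAt-after a bar-a (≢-sym v≢w) (≢-sym x≢w))
      ¬vwx-at-q : ¬ CyclicAt q v w x
      ¬vwx-at-q = cyclic-asym (cyclic-rotate (Step.cyclicAt-before tq bar-q x≢w (≢-sym v≢x)))
      from-crossing : ∃[ T ] (toℕ a < toℕ T × toℕ T < q × CrossesTwoOf v w x (bar L T)) → Narrower
      from-crossing (T , _   , T<q , inj₁ vw)        = ⊥-elim (¬cross-before v≢w cross-q vw T<q)
      from-crossing (T , a<T , T<q , inj₂ (inj₁ wx)) =
        narrower ((v≢x , x≢w , v≢w) , a<T , T<q , bar-a , isPair-sym wx , cross-q)
                 (<⇒≤ p<a) (<⇒≤ q<r) (inj₁ p<a)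
      from-crossing (T , a<T , T<q , inj₂ (inj₂ vx)) = ⊥-elim (v-free T a<T T<q (isPair⇒involves vx))

    v-moves-left-past-q : ∀ {a x} → bar L a ≡ (x , v) → p < toℕ a → toℕ a < q →
      NoneBetween (isPair u x ∘ bar L) (toℕ a) r → Narrower
    v-moves-left-past-q {a} {x} bar-a p<a a<q ux-free =
      from-crossing (cyclicAt-change (≢-sym x≢w) x≢u (≢-sym u≢w) q<r (toℕ≤length tr) wxu-after-q
                                (cyclic-asym (Step.cyclicAt-before tr bar-r x≢w x≢u)))
      where
      x≢v : x ≢ v
      x≢v = Step.bar-distinct a next≢id bar-a
      x≢w : x ≢ w
      x≢w = partner≢ v≢w cross-q (isPair-sym (≡⇒isPair bar-a)) (<⇒≢ a<q)
      x≢u : x ≢ u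
      x≢u = partner≢ (≢-sym u≢v) (isPair-sym (≡⇒isPair bar-p)) (isPair-sym (≡⇒isPair bar-a))
                     (>⇒≢ p<a)
      no-crossing : NoneBetween (CrossesTwoOf v x u ∘ bar L) (toℕ a) (suc q)
      no-crossing T a<T _     (inj₁ vx)        = ¬cross-after x≢v (≡⇒isPair bar-a) (isPair-sym vx) a<T
      no-crossing T a<T T<1+q (inj₂ (inj₁ xu)) =
        ux-free T a<T (≤-<-trans (≤-pred T<1+q) q<r) (isPair-sym xu)
      no-crossing T a<T _     (inj₂ (inj₂ vu)) =
        ¬cross-after u≢v (≡⇒isPair bar-p) (isPair-sym vu) (<-trans p<a a<T)
      vxu-after-q : CyclicAt (suc q) v x u
      vxu-after-q = cyclicAt-keep (≢-sym x≢v) x≢u (≢-sym u≢v) (m<n⇒m<1+n a<q) (toℕ<n tq) no-crossing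
                      (Step.cyclicAt-after a bar-a (≢-sym x≢u) u≢v)
      vwx-after-q : CyclicAt (suc q) v w x
      vwx-after-q = Step.cyclicAt-after tq bar-q x≢w x≢v
      wxu-after-q : CyclicAt (suc q) w x u
      wxu-after-q = cyclic-rotate (cyclic-rotate
        (cyclic-trans (cyclic-rotate vxu-after-q) (cyclic-rotate (cyclic-rotate vwx-after-q))))
      from-crossing : ∃[ T ] (q < toℕ T × toℕ T < r × CrossesTwoOf w x u (bar L T)) → Narrower
      from-crossing (T , q<T , T<r , inj₁ wx) =
        narrower ((x≢v , v≢w , x≢w) , a<q , q<T , bar-a , cross-q , isPair-sym wx)
                 (<⇒≤ p<a) (<⇒≤ T<r) (inj₁ p<a)
      from-crossing (T , q<T , T<r , inj₂ (inj₁ xu)) =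
        ⊥-elim (ux-free T (<-trans a<q q<T) T<r (isPair-sym xu))
      from-crossing (T , _ , T<r , inj₂ (inj₂ wu)) =
        ⊥-elim (¬cross-before u≢w cross-r (isPair-sym wu) T<r)

    v-moves-left : ∀ {a x} → bar L a ≡ (x , v) → p < toℕ a → toℕ a < q → Narrower
    v-moves-left {a} {x} bar-a p<a a<q
      with last-in-interval (isPair u x ∘ bar L) (isPair? u x ∘ bar L) (toℕ a) r (toℕ≤length tr)
    ... | inj₁ ux-free = v-moves-left-past-q bar-a p<a a<q ux-free
    ... | inj₂ (e , a<e , e<r , ux , _) =
      narrower ((u≢v , ≢-sym x≢v , ≢-sym x≢u) , p<a , a<e , bar-p , isPair-sym (≡⇒isPair bar-a) , ux)
               ≤-refl (<⇒≤ e<r) (inj₂ e<r)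
      where
      x≢v : x ≢ v
      x≢v = Step.bar-distinct a next≢id bar-a
      x≢u : x ≢ u
      x≢u = partner≢ (≢-sym u≢v) (isPair-sym (≡⇒isPair bar-p)) (isPair-sym (≡⇒isPair bar-a))
                     (>⇒≢ p<a)

    u-moves-right : ∀ {s x} → bar L s ≡ (u , x) → p < toℕ s → toℕ s < r → Narrower
    u-moves-right {s} {x} bar-s p<s s<r =
      from-crossing (cyclicAt-change (≢-sym u≢x) u≢w x≢w s<r (toℕ≤length tr) xuw-after-s ¬xuw-at-r)
      where
      u≢x : u ≢ x
      u≢x = Step.bar-distinct s next≢id bar-s
      x≢w : x ≢ w
      x≢w = partner≢ u≢w cross-r (≡⇒isPair bar-s) (<⇒≢ s<r)
      xuw-after-s : CyclicAt (suc (toℕ s)) x u w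
      xuw-after-s = Step.cyclicAt-after s bar-s (≢-sym u≢w) (≢-sym x≢w)
      ¬xuw-at-r : ¬ CyclicAt r x u w
      ¬xuw-at-r =
        cyclic-asym (cyclic-rotate (cyclic-rotate (Step.cyclicAt-before tr bar-r x≢w (≢-sym u≢x))))
      from-crossing : ∃[ T ] (toℕ s < toℕ T × toℕ T < r × CrossesTwoOf x u w (bar L T)) → Narrower
      from-crossing (T , s<T , _ , inj₁ xu) =
        ⊥-elim (¬cross-after u≢x (≡⇒isPair bar-s) (isPair-sym xu) s<T)
      from-crossing (T , _ , T<r , inj₂ (inj₁ uw)) = ⊥-elim (¬cross-before u≢w cross-r uw T<r)
      from-crossing (T , s<T , T<r , inj₂ (inj₂ xw)) =
        narrower ((u≢x , x≢w , u≢w) , s<T , T<r , bar-s , xw , cross-r) (<⇒≤ p<s) ≤-refl (inj₁ p<s)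

    u-moves-left : ∀ {s x} → bar L s ≡ (x , u) → p < toℕ s → toℕ s < r → Narrower
    u-moves-left {s} {x} bar-s p<s s<r =
      from-crossing
        (cyclicAt-change (≢-sym u≢v) (≢-sym x≢u) (≢-sym x≢v) p<s (toℕ≤length s) vux-after-p ¬vux-at-s)
      where
      x≢u : x ≢ u
      x≢u = Step.bar-distinct s next≢id bar-s
      x≢v : x ≢ v
      x≢v = partner≢ u≢v (≡⇒isPair bar-p) (isPair-sym (≡⇒isPair bar-s)) (>⇒≢ p<s)
      vux-after-p : CyclicAt (suc p) v u x
      vux-after-p = Step.cyclicAt-after tp bar-p x≢u x≢v
      ¬vux-at-s : ¬ CyclicAt (toℕ s) v u x
      ¬vux-at-s = cyclic-asym (cyclic-rotate (cyclic-rotate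
        (Step.cyclicAt-before s bar-s (≢-sym x≢v) (≢-sym u≢v))))
      from-crossing : ∃[ T ] (p < toℕ T × toℕ T < toℕ s × CrossesTwoOf v u x (bar L T)) → Narrower
      from-crossing (T , p<T , _ , inj₁ vu) =
        ⊥-elim (¬cross-after u≢v (≡⇒isPair bar-p) (isPair-sym vu) p<T)
      from-crossing (T , _ , T<s , inj₂ (inj₁ ux)) =
        ⊥-elim (¬cross-before (≢-sym x≢u) (isPair-sym (≡⇒isPair bar-s)) ux T<s)
      from-crossing (T , p<T , T<s , inj₂ (inj₂ vx)) =
        narrower ((u≢v , ≢-sym x≢v , ≢-sym x≢u) , p<T , T<s , bar-p , vx , isPair-sym (≡⇒isPair bar-s))
                 ≤-refl (<⇒≤ s<r) (inj₂ s<r)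

    v-segment : NoneBetween (involves v ∘ bar L) p q ⊎ Narrower
    v-segment with last-in-interval (involves v ∘ bar L) (involves? v ∘ bar L) p q (toℕ≤length tq)
    ... | inj₁ v-free = inj₁ v-free
    ... | inj₂ (a , p<a , a<q , v-at-a , v-free-after) with involves⇒≡ v-at-a
    ...   | inj₁ bar-a = inj₂ (v-moves-right bar-a p<a a<q v-free-after)
    ...   | inj₂ bar-a = inj₂ (v-moves-left bar-a p<a a<q)

    u-segment : NoneBetween (involves u ∘ bar L) p r ⊎ Narrower
    u-segment with last-in-interval (involves u ∘ bar L) (involves? u ∘ bar L) p r (toℕ≤length tr)
    ... | inj₁ u-free = inj₁ u-free
    ... | inj₂ (s , p<s , s<r , u-at-s , _) with involves⇒≡ u-at-s
    ...   | inj₁ bar-s = inj₂ (u-moves-right bar-s p<s s<r)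
    ...   | inj₂ bar-s = inj₂ (u-moves-left bar-s p<s s<r)

    module _ (v-free : NoneBetween (involves v ∘ bar L) p q)
             (u-free : NoneBetween (involves u ∘ bar L) p r) where

      ¬w-moves-left : ∀ {e x} → bar L e ≡ (x , w) → q < toℕ e → toℕ e < r → ⊥
      ¬w-moves-left {e} {x} bar-e q<e e<r =
        from-crossing
          (cyclicAt-change (≢-sym x≢w) x≢u (≢-sym u≢w) e<r (toℕ≤length tr) wxu-after-e ¬wxu-at-r)
        where
        x≢w : x ≢ w
        x≢w = Step.bar-distinct e next≢id bar-e
        x≢u : x ≢ u
        x≢u = partner≢ (≢-sym u≢w) (≡⇒isPair bar-r) (isPair-sym (≡⇒isPair bar-e)) (<⇒≢ e<r)
        wxu-after-e : CyclicAt (suc (toℕ e)) w x u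
        wxu-after-e = Step.cyclicAt-after e bar-e (≢-sym x≢u) u≢w
        ¬wxu-at-r : ¬ CyclicAt r w x u
        ¬wxu-at-r = cyclic-asym (Step.cyclicAt-before tr bar-r x≢w x≢u)
        from-crossing : ∃[ T ] (toℕ e < toℕ T × toℕ T < r × CrossesTwoOf w x u (bar L T)) → ⊥
        from-crossing (T , e<T , _ , inj₁ wx) = ¬cross-after x≢w (≡⇒isPair bar-e) (isPair-sym wx) e<T
        from-crossing (T , e<T , T<r , inj₂ (inj₁ xu)) =
          u-free T (<-trans p<q (<-trans q<e e<T)) T<r (isPair⇒involves (isPair-sym xu))
        from-crossing (T , _ , T<r , inj₂ (inj₂ wu)) = ¬cross-before u≢w cross-r (isPair-sym wu) T<r

      w-moves-right : ∀ {e x} → bar L e ≡ (w , x) → q < toℕ e → toℕ e < r → Narrower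
      w-moves-right {e} {x} bar-e q<e e<r =
        from-crossing
          (cyclicAt-change (≢-sym u≢v) (≢-sym x≢u) (≢-sym x≢v) (<-trans p<q q<e) (toℕ≤length e)
                           (Step.cyclicAt-after tp bar-p x≢u x≢v) (cyclic-asym vxu-at-e))
        where
        w≢x : w ≢ x
        w≢x = Step.bar-distinct e next≢id bar-e
        x≢v : x ≢ v
        x≢v = partner≢ (≢-sym v≢w) (≡⇒isPair bar-q) (≡⇒isPair bar-e) (>⇒≢ q<e)
        x≢u : x ≢ u
        x≢u = partner≢ (≢-sym u≢w) (≡⇒isPair bar-r) (≡⇒isPair bar-e) (<⇒≢ e<r)
        wxu-at-e : CyclicAt (toℕ e) w x u
        wxu-at-e = Step.cyclicAt-before e bar-e u≢w (≢-sym x≢u)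
        vxu-at-e : CyclicAt (toℕ e) v x u
        vxu-at-e = cyclic-rotate (cyclic-trans (cyclic-rotate (cyclic-rotate (vwu-at q<e (<⇒≤ e<r))))
                                               (cyclic-rotate (cyclic-rotate wxu-at-e)))
        ¬vx-at-q : ¬ isPair v x (w , v)
        ¬vx-at-q (inj₁ (w≡v , _)) = v≢w (sym w≡v)
        ¬vx-at-q (inj₂ (w≡x , _)) = w≢x w≡x
        from-crossing : ∃[ T ] (p < toℕ T × toℕ T < toℕ e × CrossesTwoOf v u x (bar L T)) → Narrower
        from-crossing (T , p<T , _ , inj₁ vu) =
          ⊥-elim (¬cross-after u≢v (≡⇒isPair bar-p) (isPair-sym vu) p<T)
        from-crossing (T , p<T , T<e , inj₂ (inj₁ ux)) =
          ⊥-elim (u-free T p<T (<-trans T<e e<r) (isPair⇒involves ux))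
        from-crossing (T , p<T , T<e , inj₂ (inj₂ vx)) with <-cmp (toℕ T) q
        ... | tri< T<q _ _ = ⊥-elim (v-free T p<T T<q (isPair⇒involves vx))
        ... | tri≈ _ T≡q _ =
          ⊥-elim (¬vx-at-q (subst (isPair v x) (trans (cong (bar L) (toℕ-injective T≡q)) bar-q) vx))
        ... | tri> _ _ q<T =
          narrower ((≢-sym v≢w , ≢-sym x≢v , w≢x) , q<T , T<e , bar-q , vx , ≡⇒isPair bar-e)
                   (<⇒≤ p<q) (<⇒≤ e<r) (inj₁ p<q)

      w-segment : NoneBetween (involves w ∘ bar L) q r ⊎ Narrower
      w-segment with last-in-interval (involves w ∘ bar L) (involves? w ∘ bar L) q r (toℕ≤length tr)
      ... | inj₁ w-free = inj₁ w-free
      ... | inj₂ (e , q<e , e<r , w-at-e , _) with involves⇒≡ w-at-e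
      ...   | inj₁ bar-e = inj₂ (w-moves-right bar-e q<e e<r)
      ...   | inj₂ bar-e = ⊥-elim (¬w-moves-left bar-e q<e e<r)

    descend : Narrower ⊎ Minimal L u v w tp tq tr
    descend with v-segment | u-segment
    ... | inj₂ smaller | _             = inj₁ smaller
    ... | inj₁ _       | inj₂ smaller  = inj₁ smaller
    ... | inj₁ v-free  | inj₁ u-free with w-segment v-free u-free
    ...   | inj₂ smaller = inj₁ smaller
    ...   | inj₁ w-free  = inj₂ (v-free , w-free , u-free)

  minimal-from : (t : HasLeftTangled L) → Acc _<_ (span t) → HasMinimalLeftTangled L
  minimal-from (u , v , w , tp , tq , tr , lt@((u≢v , v≢w , u≢w) , p<q , q<r , bar-p , cross-q , cross-r))
                (acc smaller) with Triangle.descend u≢v v≢w u≢w p<q q<r bar-p cross-q cross-r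
  ... | inj₁ (t′ , t′<t) = minimal-from t′ (smaller t′<t)
  ... | inj₂ minimal     = u , v , w , tp , tq , tr , lt , minimal

minimal-left-tangled : ∀ {n} (L : Lottery n) → AtMostOnce L → HasLeftTangled L → HasMinimalLeftTangled L
minimal-left-tangled L once t@(_ , _ , _ , _ , _ , _ , (u≢v , _) , _) =
  Descent.minimal-from L (next≢ u≢v) once t (<-wellFounded _)

corollary4 : (n : ℕ) (π : Permutation′ n) (y : Fin n → ℤ) →
    AlmostOptimal π y →
    (∃[ L ] (InL1y π y L × HasTangled L)) →
    (L : Lottery n) → InL1y π y L → HasLeftTangled L → HasMinimalLeftTangled L
corollary4 _ _ _ _ _ L ((_ , once) , _) = minimal-left-tangled L once
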